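{- Let $q$ be a prime power, let $a,c$ be fixed non-zero elements of $\mathbb{F}_q$, and let $e$ be a positive divisor of $q-1$. If $\mathrm{Rad}(e)=\mathrm{Rad}(q-1)$ set $s=0$ and $\delta=1$; otherwise let $p_1,\ldots,p_s$ ($s\ge 1$) be the primes dividing $q-1$ but not $e$, and set $\delta=1-\sum_{i=1}^s 2p_i^{ -1}$. Then $$N(q-1,q-1)\geq \sum_{i=1}^s N(p_ie,e)+\sum_{i=1}^s N(e,p_ie)-(2s-1)N(e,e),$$ and hence $$N(q-1,q-1)\geq \sum_{i=1}^s\Big\{\big[N(p_ie,e)-\theta(p_i)N(e,e)\big]+\big[N(e,p_ie)-\theta(p_i)N(e,e)\big]\Big\}+\delta\,N(e,e).$$
   Context: For a divisor $f$ of $q-1$, an element $g\in\mathbb{F}_q$ is called $f$-free if $g\neq 0$ and whenever $g=h^d$ with $h\in\mathbb{F}_q$ and $d\mid f$, we have $d=1$. (Thus primitive roots are exactly the $(q-1)$-free elements.) For $g\in\mathbb{F}_q$ write $g^*=a-cg$. For divisors $e_1,e_2$ of $q-1$, $N(e_1,e_2)$ denotes the number of $g\in\mathbb{F}_q$ such that $g$ is $e_1$-free and $g^*$ is $e_2$-free. $\mathrm{Rad}(n)$ is the product of the distinct primes dividing $n$, and $\theta(n)=\prod_{p\mid n}(1-p^{ -1})$ (product over primes). Empty sums are $0$. -}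

module Defs where

open import Level using (0ℓ)
open import Data.Nat as ℕ using (ℕ; zero; suc; _∸_; _^_)
open import Data.Nat.Divisibility using (_∣_; _∣?_)
open import Data.Nat.Primality using (Prime; prime?)
open import Data.Integer as ℤ using (ℤ; +_)
open import Data.Rational as ℚ using (ℚ; 0ℚ; 1ℚ)
open import Data.List using (List; length; filter; upTo; map; sum; product; foldr)
open import Data.List.Membership.Propositional using (_∈_)
open import Data.List.Relation.Unary.Unique.Propositional using (Unique)
open import Data.Product using (Σ; ∃; _×_; _,_)
open import Relation.Nullary using (¬_; ¬?)
open import Relation.Nullary.Decidable using (_×-dec_)
open import Relation.Binary.PropositionalEquality using (_≡_; _≢_)
open import Algebra.Core using (Op₁; Op₂)
open import Algebra.Structures using (IsCommutativeRing)
open import Function.Bundles using (_⇔_)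

record FiniteField : Set₁ where
  field
    Carrier : Set
    _+_ _*_ : Op₂ Carrier
    -_      : Op₁ Carrier
    0# 1#   : Carrier
    isCommutativeRing : IsCommutativeRing _≡_ _+_ _*_ -_ 0# 1#
    0≢1     : 0# ≢ 1#
    inverse : ∀ x → x ≢ 0# → ∃ λ y → x * y ≡ 1#
    elements : List Carrier
    unique   : Unique elements
    complete : ∀ x → x ∈ elements

  order : ℕ
  order = length elements

  _-_ : Op₂ Carrier
  x - y = x + (- y)

  pow : Carrier → ℕ → Carrier
  pow h zero    = 1#
  pow h (suc d) = h * pow h d

  IsFree : ℕ → Carrier → Set
  IsFree f g = g ≢ 0# × (∀ (h : Carrier) (d : ℕ) → d ∣ f → g ≡ pow h d → d ≡ 1)

  HasCount : (Carrier → Set) → ℕ → Set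
  HasCount P n = Σ (List Carrier) λ xs → Unique xs × (∀ x → (x ∈ xs) ⇔ P x) × length xs ≡ n

  IsN : (a c : Carrier) → ℕ → ℕ → ℕ → Set
  IsN a c e₁ e₂ n = HasCount (λ g → IsFree e₁ g × IsFree e₂ (a - (c * g))) n

-- 1/n as a rational (with the harmless convention 1/0 = 0; only used for primes)
inv : ℕ → ℚ
inv zero    = 0ℚ
inv (suc n) = + 1 ℚ./ suc n

primesDividingNotDividing : ℕ → ℕ → List ℕ
primesDividingNotDividing m e =
  filter (λ p → prime? p ×-dec (p ∣? m) ×-dec ¬? (p ∣? e)) (upTo (suc m))

primeDivisors : ℕ → List ℕ
primeDivisors n = filter (λ p → prime? p ×-dec (p ∣? n)) (upTo (suc n))

θ : ℕ → ℚ
θ n = foldr ℚ._*_ 1ℚ (map (λ p → 1ℚ ℚ.- inv p) (primeDivisors n))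

sumℤ : List ℤ → ℤ
sumℤ = foldr ℤ._+_ (+ 0)

sumℚ : List ℚ → ℚ
sumℚ = foldr ℚ._+_ 0ℚ

{-# OPTIONS --safe #-}

-- Put m = q − 1 and let E be the set counted by N(e,e). An element is m-free as soon as it is
-- r-free for every prime r ∣ m, and for r ∣ e this already follows from being e-free; so an
-- element of E that lies in each of the 2s sets counted by N(pᵢe,e) and N(e,pᵢe) is counted by
-- N(m,m). All 2s sets lie in E, and the union bound over their complements in E gives
-- N(e,e) − N(m,m) ≤ Σᵢ (N(e,e) − N(pᵢe,e)) + Σᵢ (N(e,e) − N(e,pᵢe)), the first inequality. The
-- second has the same right-hand side once θ(pᵢ) = 1 − 1/pᵢ is substituted. Equality in the field
-- is not assumed decidable, but the field is finite, so it is decidable under a double negation,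
-- which is harmless for an inequality between natural numbers.
module Submission where

open import Defs
open import Level using (0ℓ)
open import Function using (id)
open import Data.Nat as ℕ using (ℕ; zero; suc; _∸_; _^_; _≥_; _≤_; _<_; z≤n; s≤s; NonZero)
import Data.Nat.Properties as ℕP
open import Data.Nat.ListAction using (sum; product)
open import Data.Nat.ListAction.Properties using (sum-++)
open import Data.Nat.Divisibility using (_∣_; divides; _∣?_; ∣-refl; ∣-trans; ∣⇒≤; 0∣⇒≡0; m∣m*n; n∣m*n; *-monoˡ-∣)
open import Data.Nat.Primality using (Prime; prime?; euclidsLemma; prime⇒irreducible; prime⇒nonTrivial; prime⇒nonZero)
open import Data.Nat.Primality.Factorisation using (factorise)
open import Data.Integer as ℤ using (ℤ; +_)
import Data.Integer.Properties as ℤP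
open import Data.Integer.Tactic.RingSolver using (solve-∀)
open import Data.Rational as ℚ using (ℚ; 0ℚ; 1ℚ)
import Data.Rational.Properties as ℚP
import Data.Rational.Solver as ℚSolver
open import Data.Rational.Unnormalised as ℚᵘ using (*≡*; *≤*)
import Data.Rational.Unnormalised.Properties as ℚᵘP
open import Data.List using (List; []; _∷_; _++_; length; map; filter; concat; upTo; foldr)
open import Data.List.Properties using (length-++; length-map; map-++; map-∘; map-cong-local; filter-none; filter-++; filter-accept; upTo-∷ʳ)
open import Data.List.Membership.Propositional using (_∈_)
open import Data.List.Membership.Propositional.Properties using (∈-filter⁺; ∈-filter⁻; ∈-++⁻; ∈-++⁺ˡ; ∈-++⁺ʳ; ∈-concat⁺; ∈-upTo⁺)
open import Data.List.Relation.Binary.Subset.Propositional using (_⊆_)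
open import Data.List.Relation.Binary.Disjoint.Propositional using (Disjoint)
open import Data.List.Relation.Unary.Any as Any using (here; there)
open import Data.List.Relation.Unary.All as All using (All; []; _∷_)
open import Data.List.Relation.Unary.All.Properties using (¬All⇒Any¬; all-upTo; ++⁻; map⁻) renaming (++⁺ to All-++⁺; map⁺ to All-map⁺)
open import Data.List.Relation.Unary.Any.Properties using () renaming (map⁺ to Any-map⁺)
open import Data.List.Relation.Unary.Unique.Propositional using (Unique; _∷_)
open import Data.List.Relation.Unary.Unique.Propositional.Properties using (++⁺; filter⁺; Unique[x∷xs]⇒x∉xs)
open import Data.Product using (Σ; ∃; _×_; _,_; proj₁; proj₂; <_,_>)
open import Data.Sum using (_⊎_; inj₁; inj₂; map₂)
open import Relation.Nullary using (¬_; Dec; yes; no; ¬?; contradiction)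
open import Relation.Nullary.Decidable using (_×-dec_; decidable-stable; ¬¬-excluded-middle)
open import Relation.Nullary.Negation using (¬¬-Monad; ¬¬-map)
open import Relation.Binary.Definitions using (DecidableEquality)
open import Relation.Binary.PropositionalEquality using (_≡_; _≢_; refl; sym; trans; cong; cong₂; subst; subst₂; module ≡-Reasoning)
open import Function.Bundles using (_⇔_; Equivalence)
open import Algebra.Structures using (IsCommutativeRing)
open import Algebra.Properties.CommutativeSemigroup ℕP.+-commutativeSemigroup using (interchange)

-- Counting with lists

module _ {A : Set} where

  sum-map-+ : ∀ (f g : A → ℕ) xs → sum (map (λ x → f x ℕ.+ g x) xs) ≡ sum (map f xs) ℕ.+ sum (map g xs)
  sum-map-+ f g []       = refl
  sum-map-+ f g (x ∷ xs) = trans (cong (f x ℕ.+ g x ℕ.+_) (sum-map-+ f g xs)) (interchange (f x) (g x) _ _)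

  sum-map-≤-length* : ∀ {f : A → ℕ} {c xs} → All (λ x → f x ≤ c) xs → sum (map f xs) ≤ length xs ℕ.* c
  sum-map-≤-length* []           = z≤n
  sum-map-≤-length* (fx≤c ∷ f≤c) = ℕP.+-mono-≤ fx≤c (sum-map-≤-length* f≤c)

  length-concat : (xss : List (List A)) → length (concat xss) ≡ sum (map length xss)
  length-concat []         = refl
  length-concat (xs ∷ xss) = trans (length-++ xs) (cong (length xs ℕ.+_) (length-concat xss))

module _ {A : Set} where

  private
    remove-∈ : ∀ {x : A} {ys} → x ∈ ys →
               ∃ λ ys′ → length ys ≡ suc (length ys′) × (∀ {y} → y ∈ ys → y ≡ x ⊎ y ∈ ys′)
    remove-∈ {ys = _ ∷ ys} (here refl) = ys , refl , λ { (here y≡x) → inj₁ y≡x ; (there y∈ys) → inj₂ y∈ys }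
    remove-∈ {ys = y ∷ _}  (there x∈ys) with remove-∈ x∈ys
    ... | ys′ , |ys|≡ , split = y ∷ ys′ , cong suc |ys|≡ ,
          λ { (here refl) → inj₂ (here refl) ; (there z∈ys) → map₂ there (split z∈ys) }

  Unique⇒length-≤ : ∀ {xs ys : List A} → Unique xs → xs ⊆ ys → length xs ≤ length ys
  Unique⇒length-≤ {[]}     _               _     = z≤n
  Unique⇒length-≤ {x ∷ xs} x∷xs!@(_ ∷ xs!) xs⊆ys with remove-∈ (xs⊆ys (here refl))
  ... | ys′ , |ys|≡ , split = subst (suc (length xs) ≤_) (sym |ys|≡) (s≤s (Unique⇒length-≤ xs! xs⊆ys′))
    where
    xs⊆ys′ : xs ⊆ ys′
    xs⊆ys′ y∈xs with split (xs⊆ys (there y∈xs))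
    ... | inj₁ refl  = contradiction y∈xs (Unique[x∷xs]⇒x∉xs x∷xs!)
    ... | inj₂ y∈ys′ = y∈ys′

  module _ (_≟_ : DecidableEquality A) where

    open import Data.List.Membership.DecPropositional _≟_ using (_∈?_; _∉?_)

    infixl 5 _∖_
    _∖_ : List A → List A → List A
    xs ∖ ys = filter (_∉? ys) xs

    length-⊆+length-∖≤ : ∀ {xs ys} → Unique xs → Unique ys → ys ⊆ xs →
                         length ys ℕ.+ length (xs ∖ ys) ≤ length xs
    length-⊆+length-∖≤ {xs} {ys} xs! ys! ys⊆xs =
      subst (_≤ length xs) (length-++ ys) (Unique⇒length-≤ (++⁺ ys! (filter⁺ _ xs!) disjoint) ys++xs∖ys⊆xs)
      where
      disjoint : Disjoint ys (xs ∖ ys)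
      disjoint (v∈ys , v∈xs∖ys) = proj₂ (∈-filter⁻ (_∉? ys) {xs = xs} v∈xs∖ys) v∈ys
      ys++xs∖ys⊆xs : ys ++ (xs ∖ ys) ⊆ xs
      ys++xs∖ys⊆xs v∈ with ∈-++⁻ ys v∈
      ... | inj₁ v∈ys    = ys⊆xs v∈ys
      ... | inj₂ v∈xs∖ys = proj₁ (∈-filter⁻ (_∉? ys) {xs = xs} v∈xs∖ys)

    union-bound : ∀ {E X} (Ls : List (List A)) → Unique E → (∀ {x} → x ∈ E → All (x ∈_) Ls → x ∈ X) →
                  length E ≤ length X ℕ.+ sum (map (λ L → length (E ∖ L)) Ls)
    union-bound {E} {X} Ls E! E∩Ls⊆X = subst (length E ≤_) |cover| (Unique⇒length-≤ E! E⊆cover)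
      where
      E⊆cover : E ⊆ X ++ concat (map (E ∖_) Ls)
      E⊆cover {x} x∈E with All.all? (x ∈?_) Ls
      ... | yes x∈Ls = ∈-++⁺ˡ (E∩Ls⊆X x∈E x∈Ls)
      ... | no  x∉Ls = ∈-++⁺ʳ X (∈-concat⁺ (Any-map⁺ (Any.map (∈-filter⁺ (_∉? _) x∈E) (¬All⇒Any¬ (x ∈?_) Ls x∉Ls))))
      |cover| : length (X ++ concat (map (E ∖_) Ls)) ≡ length X ℕ.+ sum (map (λ L → length (E ∖ L)) Ls)
      |cover| = trans (length-++ X) (cong (length X ℕ.+_)
                  (trans (length-concat (map (E ∖_) Ls)) (cong sum (sym (map-∘ Ls)))))

    counting : ∀ {E X} (Ls : List (List A)) → Unique E → All Unique Ls → All (_⊆ E) Ls →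
               (∀ {x} → x ∈ E → All (x ∈_) Ls → x ∈ X) →
               length E ℕ.+ sum (map length Ls) ≤ length X ℕ.+ length Ls ℕ.* length E
    counting {E} {X} Ls E! Ls! Ls⊆E E∩Ls⊆X = begin
      length E ℕ.+ ΣL                   ≤⟨ ℕP.+-monoˡ-≤ ΣL (union-bound Ls E! E∩Ls⊆X) ⟩
      length X ℕ.+ Σ∖ ℕ.+ ΣL            ≡⟨ ℕP.+-assoc (length X) Σ∖ ΣL ⟩
      length X ℕ.+ (Σ∖ ℕ.+ ΣL)          ≡⟨ cong (length X ℕ.+_) (trans (ℕP.+-comm Σ∖ ΣL) (sym (sum-map-+ length _ Ls))) ⟩
      length X ℕ.+ sum (map (λ L → length L ℕ.+ length (E ∖ L)) Ls)
        ≤⟨ ℕP.+-monoʳ-≤ (length X) (sum-map-≤-length* {f = λ L → length L ℕ.+ length (E ∖ L)} (All.zipWith split-bound (Ls! , Ls⊆E))) ⟩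
      length X ℕ.+ length Ls ℕ.* length E ∎
      where
      open ℕP.≤-Reasoning
      ΣL = sum (map length Ls)
      Σ∖ = sum (map (λ L → length (E ∖ L)) Ls)
      split-bound : ∀ {L} → Unique L × L ⊆ E → length L ℕ.+ length (E ∖ L) ≤ length E
      split-bound (L! , L⊆E) = length-⊆+length-∖≤ E! L! L⊆E

¬¬-decEq-of-enumeration : ∀ {A : Set} (xs : List A) → (∀ x → x ∈ xs) → ¬ ¬ DecidableEquality A
¬¬-decEq-of-enumeration {A} xs xs-complete =
  ¬¬-map decide (All.sequenceM 0ℓ ¬¬-Monad (All.tabulate λ _ → All.sequenceM 0ℓ ¬¬-Monad (All.tabulate λ _ → ¬¬-excluded-middle)))
  where
  decide : All (λ x → All (λ y → Dec (x ≡ y)) xs) xs → DecidableEquality A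
  decide dec x y = All.lookup (All.lookup dec (xs-complete x)) (xs-complete y)

-- Primes

prime-divisor : ∀ n → .{{ℕ.NonTrivial n}} → ∃ λ r → Prime r × r ∣ n
prime-divisor n@(suc (suc _)) with factorise n
... | record { factors = r ∷ rs ; isFactorisation = n≡r*Πrs ; factorsPrime = r-prime ∷ _ } =
  r , r-prime , subst (r ∣_) (sym n≡r*Πrs) (m∣m*n (product rs))

prime∤⇒*∣ : ∀ {p e m} → Prime p → ¬ p ∣ e → p ∣ m → e ∣ m → p ℕ.* e ∣ m
prime∤⇒*∣ {p} {e} p-prime p∤e p∣m (divides k refl) with euclidsLemma k e p-prime p∣m
... | inj₁ p∣k = *-monoˡ-∣ e p∣k
... | inj₂ p∣e = contradiction p∣e p∤e

prime^suc>1 : ∀ {p k} → Prime p → 1 ≤ k → 1 < p ^ k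
prime^suc>1 {p} {suc k} p-prime _ =
  ℕP.<-≤-trans (ℕ.nonTrivial⇒n>1 p {{prime⇒nonTrivial p-prime}}) (ℕP.m≤m*n p (p ^ k) {{ℕP.m^n≢0 p k {{prime⇒nonZero p-prime}}}})

∈-primesDividingNotDividing⁻ : ∀ {m e p} → p ∈ primesDividingNotDividing m e → Prime p × p ∣ m × ¬ p ∣ e
∈-primesDividingNotDividing⁻ {m} {e} p∈ =
  proj₂ (∈-filter⁻ (λ p → prime? p ×-dec (p ∣? m) ×-dec ¬? (p ∣? e)) {xs = upTo (suc m)} p∈)

∈-primesDividingNotDividing⁺ : ∀ {m e p} .{{_ : NonZero m}} → Prime p → p ∣ m → ¬ p ∣ e →
                               p ∈ primesDividingNotDividing m e
∈-primesDividingNotDividing⁺ {m} {e} p-prime p∣m p∤e =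
  ∈-filter⁺ (λ p → prime? p ×-dec (p ∣? m) ×-dec ¬? (p ∣? e)) (∈-upTo⁺ (s≤s (∣⇒≤ p∣m))) (p-prime , p∣m , p∤e)

primeDivisors-prime : ∀ {p} → Prime p → primeDivisors p ≡ p ∷ []
primeDivisors-prime {p} p-prime = begin
  filter P? (upTo (suc p))                  ≡⟨ cong (filter P?) (sym (upTo-∷ʳ p)) ⟩
  filter P? (upTo p ++ p ∷ [])              ≡⟨ filter-++ P? (upTo p) (p ∷ []) ⟩
  filter P? (upTo p) ++ filter P? (p ∷ [])  ≡⟨ cong₂ _++_ (filter-none P? (All.map none (all-upTo p)))
                                                          (filter-accept P? {xs = []} (p-prime , ∣-refl)) ⟩
  p ∷ []                                    ∎
  where
  open ≡-Reasoning
  P? = λ d → prime? d ×-dec (d ∣? p)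
  none : ∀ {d} → d < p → ¬ (Prime d × d ∣ p)
  none d<p (d-prime , d∣p) with prime⇒irreducible p-prime d∣p
  ... | inj₁ refl = ℕ.nonTrivial⇒≢1 {{prime⇒nonTrivial d-prime}} refl
  ... | inj₂ refl = ℕP.<-irrefl refl d<p

θ-prime : ∀ {p} → Prime p → θ p ≡ 1ℚ ℚ.- inv p
θ-prime {p} p-prime = trans (cong (λ ps → foldr ℚ._*_ 1ℚ (map (λ p → 1ℚ ℚ.- inv p) ps)) (primeDivisors-prime p-prime))
                            (ℚP.*-identityʳ _)

-- Integer and rational arithmetic

ι : ℤ → ℚ
ι i = i ℚ./ 1

private
  toℚᵘ-ι : ∀ i → ℚ.toℚᵘ (ι i) ℚᵘ.≃ i ℚᵘ./ 1
  toℚᵘ-ι i = ℚP.toℚᵘ-fromℚᵘ (i ℚᵘ./ 1)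

ι-+ : ∀ i j → ι (i ℤ.+ j) ≡ ι i ℚ.+ ι j
ι-+ i j = ℚP.toℚᵘ-injective (begin
  ℚ.toℚᵘ (ι (i ℤ.+ j))               ≈⟨ toℚᵘ-ι (i ℤ.+ j) ⟩
  (i ℤ.+ j) ℚᵘ./ 1                   ≈⟨ *≡* (numerators i j) ⟩
  i ℚᵘ./ 1 ℚᵘ.+ j ℚᵘ./ 1              ≈⟨ ℚᵘP.+-cong (toℚᵘ-ι i) (toℚᵘ-ι j) ⟨
  ℚ.toℚᵘ (ι i) ℚᵘ.+ ℚ.toℚᵘ (ι j)      ≈⟨ ℚP.toℚᵘ-homo-+ (ι i) (ι j) ⟨
  ℚ.toℚᵘ (ι i ℚ.+ ι j)                ∎)
  where
  open ℚᵘP.≃-Reasoning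
  numerators : ∀ i j → (i ℤ.+ j) ℤ.* + 1 ≡ (i ℤ.* + 1 ℤ.+ j ℤ.* + 1) ℤ.* + 1
  numerators = solve-∀

ι-* : ∀ i j → ι (i ℤ.* j) ≡ ι i ℚ.* ι j
ι-* i j = ℚP.toℚᵘ-injective (begin
  ℚ.toℚᵘ (ι (i ℤ.* j))               ≈⟨ toℚᵘ-ι (i ℤ.* j) ⟩
  (i ℤ.* j) ℚᵘ./ 1                   ≈⟨ *≡* refl ⟩
  (i ℚᵘ./ 1) ℚᵘ.* (j ℚᵘ./ 1)          ≈⟨ ℚᵘP.*-cong (toℚᵘ-ι i) (toℚᵘ-ι j) ⟨
  ℚ.toℚᵘ (ι i) ℚᵘ.* ℚ.toℚᵘ (ι j)      ≈⟨ ℚP.toℚᵘ-homo-* (ι i) (ι j) ⟨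
  ℚ.toℚᵘ (ι i ℚ.* ι j)                ∎)
  where open ℚᵘP.≃-Reasoning

ι-neg : ∀ i → ι (ℤ.- i) ≡ ℚ.- ι i
ι-neg i = ℚP.toℚᵘ-injective (begin
  ℚ.toℚᵘ (ι (ℤ.- i))   ≈⟨ toℚᵘ-ι (ℤ.- i) ⟩
  ℚᵘ.- (i ℚᵘ./ 1)       ≈⟨ ℚᵘP.-‿cong (toℚᵘ-ι i) ⟨
  ℚᵘ.- ℚ.toℚᵘ (ι i)     ≈⟨ ℚP.toℚᵘ-homo‿- (ι i) ⟨
  ℚ.toℚᵘ (ℚ.- ι i)      ∎)
  where open ℚᵘP.≃-Reasoning

ι-‐ : ∀ i j → ι (i ℤ.- j) ≡ ι i ℚ.- ι j
ι-‐ i j = trans (ι-+ i (ℤ.- j)) (cong (ι i ℚ.+_) (ι-neg j))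

ι-mono-≤ : ∀ {i j} → i ℤ.≤ j → ι i ℚ.≤ ι j
ι-mono-≤ {i} {j} i≤j = ℚP.toℚᵘ-cancel-≤
  (ℚᵘP.≤-respˡ-≃ (ℚᵘP.≃-sym (toℚᵘ-ι i)) (ℚᵘP.≤-respʳ-≃ (ℚᵘP.≃-sym (toℚᵘ-ι j)) (*≤* (ℤP.*-monoʳ-≤-nonNeg (+ 1) i≤j))))

ι-2*suc : ∀ s → ι (+ (2 ℕ.* suc s)) ≡ (+ 2 ℚ./ 1) ℚ.+ ι (+ (2 ℕ.* s))
ι-2*suc s = trans (cong (λ t → ι (+ t)) (ℕP.*-suc 2 s)) (trans (cong ι (ℤP.pos-+ 2 (2 ℕ.* s))) (ι-+ (+ 2) (+ (2 ℕ.* s))))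

sumℤ-map-+ : ∀ {A : Set} (f : A → ℕ) xs → sumℤ (map (λ x → + f x) xs) ≡ + sum (map f xs)
sumℤ-map-+ f []       = refl
sumℤ-map-+ f (x ∷ xs) = trans (cong (ℤ._+_ (+ f x)) (sumℤ-map-+ f xs)) (sym (ℤP.pos-+ (f x) _))

ι-sumℤ-map : ∀ {A : Set} (f : A → ℤ) xs → ι (sumℤ (map f xs)) ≡ sumℚ (map (λ x → ι (f x)) xs)
ι-sumℤ-map f []       = refl
ι-sumℤ-map f (x ∷ xs) = trans (ι-+ (f x) _) (cong (ι (f x) ℚ.+_) (ι-sumℤ-map f xs))

ℕ≤⇒ℤ-bound : ∀ {A : Set} (f g : A → ℕ) xs {n x k} →
             n ℕ.+ (sum (map f xs) ℕ.+ sum (map g xs)) ≤ x ℕ.+ k ℕ.* n →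
             (sumℤ (map (λ y → + f y) xs) ℤ.+ sumℤ (map (λ y → + g y) xs)) ℤ.- ((+ k ℤ.- + 1) ℤ.* + n) ℤ.≤ + x
ℕ≤⇒ℤ-bound f g xs {n} {x} {k} hyp = begin
  (sumℤ (map (λ y → + f y) xs) ℤ.+ sumℤ (map (λ y → + g y) xs)) ℤ.- ((+ k ℤ.- + 1) ℤ.* + n)
                                              ≡⟨ cong₂ (λ s t → (s ℤ.+ t) ℤ.- ((+ k ℤ.- + 1) ℤ.* + n)) (sumℤ-map-+ f xs) (sumℤ-map-+ g xs) ⟩
  (+ a ℤ.+ + b) ℤ.- ((+ k ℤ.- + 1) ℤ.* + n)  ≡⟨ rearrange (+ a) (+ b) (+ k) (+ n) ⟩
  (+ n ℤ.+ (+ a ℤ.+ + b)) ℤ.- + k ℤ.* + n    ≡⟨ cong (ℤ._- + k ℤ.* + n) (sym n+⟨a+b⟩) ⟩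
  + (n ℕ.+ (a ℕ.+ b)) ℤ.- + k ℤ.* + n        ≤⟨ ℤP.+-monoˡ-≤ (ℤ.- (+ k ℤ.* + n)) (ℤ.+≤+ hyp) ⟩
  + (x ℕ.+ k ℕ.* n) ℤ.- + k ℤ.* + n          ≡⟨ cong (ℤ._- + k ℤ.* + n) x+k*n ⟩
  (+ x ℤ.+ + k ℤ.* + n) ℤ.- + k ℤ.* + n      ≡⟨ cancel (+ x) (+ k ℤ.* + n) ⟩
  + x                                         ∎
  where
  open ℤP.≤-Reasoning
  a = sum (map f xs)
  b = sum (map g xs)
  rearrange : ∀ a b k n → (a ℤ.+ b) ℤ.- ((k ℤ.- + 1) ℤ.* n) ≡ (n ℤ.+ (a ℤ.+ b)) ℤ.- k ℤ.* n
  rearrange = solve-∀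
  cancel : ∀ x y → (x ℤ.+ y) ℤ.- y ≡ x
  cancel = solve-∀
  n+⟨a+b⟩ : + (n ℕ.+ (a ℕ.+ b)) ≡ + n ℤ.+ (+ a ℤ.+ + b)
  n+⟨a+b⟩ = trans (ℤP.pos-+ n _) (cong (ℤ._+_ (+ n)) (ℤP.pos-+ a b))
  x+k*n : + (x ℕ.+ k ℕ.* n) ≡ + x ℤ.+ + k ℤ.* + n
  x+k*n = trans (ℤP.pos-+ x _) (cong (ℤ._+_ (+ x)) (ℤP.pos-* k n))

module _ (f g : ℕ → ℚ) (x : ℚ) where

  private
    open ℚSolver.+-*-Solver
    two = + 2 ℚ./ 1

  sumℚ-θ-terms : ∀ {ps} → All Prime ps →
    sumℚ (map (λ p → (f p ℚ.- θ p ℚ.* x) ℚ.+ (g p ℚ.- θ p ℚ.* x)) ps)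
      ≡ (sumℚ (map f ps) ℚ.+ sumℚ (map g ps))
        ℚ.- (ι (+ (2 ℕ.* length ps)) ℚ.- sumℚ (map (λ p → two ℚ.* inv p) ps)) ℚ.* x
  sumℚ-θ-terms []       = solve 1 (λ x → con 0ℚ := (con 0ℚ :+ con 0ℚ) :- (con 0ℚ :- con 0ℚ) :* x) refl x
  sumℚ-θ-terms {p ∷ ps} (p-prime ∷ ps-prime) = begin
    term (θ p) ℚ.+ sumℚ (map (λ q → (f q ℚ.- θ q ℚ.* x) ℚ.+ (g q ℚ.- θ q ℚ.* x)) ps)
      ≡⟨ cong₂ ℚ._+_ (cong term (θ-prime p-prime)) (sumℚ-θ-terms ps-prime) ⟩
    term (1ℚ ℚ.- inv p) ℚ.+ ((Sf ℚ.+ Sg) ℚ.- (c ℚ.- T) ℚ.* x)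
      ≡⟨ solve 8 (λ fp gp i x Sf Sg c T →
            ((fp :- (con 1ℚ :- i) :* x) :+ (gp :- (con 1ℚ :- i) :* x)) :+ ((Sf :+ Sg) :- (c :- T) :* x)
            := ((fp :+ Sf) :+ (gp :+ Sg)) :- ((con two :+ c) :- (con two :* i :+ T)) :* x)
          refl (f p) (g p) (inv p) x Sf Sg c T ⟩
    ((f p ℚ.+ Sf) ℚ.+ (g p ℚ.+ Sg)) ℚ.- ((two ℚ.+ c) ℚ.- (two ℚ.* inv p ℚ.+ T)) ℚ.* x
      ≡⟨ cong (λ c′ → ((f p ℚ.+ Sf) ℚ.+ (g p ℚ.+ Sg)) ℚ.- (c′ ℚ.- (two ℚ.* inv p ℚ.+ T)) ℚ.* x) (ι-2*suc (length ps)) ⟨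
    ((f p ℚ.+ Sf) ℚ.+ (g p ℚ.+ Sg)) ℚ.- (ι (+ (2 ℕ.* length (p ∷ ps))) ℚ.- (two ℚ.* inv p ℚ.+ T)) ℚ.* x ∎
    where
    open ≡-Reasoning
    term : ℚ → ℚ
    term t = (f p ℚ.- t ℚ.* x) ℚ.+ (g p ℚ.- t ℚ.* x)
    Sf = sumℚ (map f ps)
    Sg = sumℚ (map g ps)
    c = ι (+ (2 ℕ.* length ps))
    T = sumℚ (map (λ p → two ℚ.* inv p) ps)

ℤ-bound⇒ℚ-bound : ∀ (f g : ℕ → ℤ) {ps x n} → All Prime ps →
  x ℤ.≥ (sumℤ (map f ps) ℤ.+ sumℤ (map g ps)) ℤ.- ((+ (2 ℕ.* length ps) ℤ.- + 1) ℤ.* n) →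
  ι x ℚ.≥ sumℚ (map (λ p → (ι (f p) ℚ.- θ p ℚ.* ι n) ℚ.+ (ι (g p) ℚ.- θ p ℚ.* ι n)) ps)
          ℚ.+ (1ℚ ℚ.- sumℚ (map (λ p → (+ 2 ℚ./ 1) ℚ.* inv p) ps)) ℚ.* ι n
ℤ-bound⇒ℚ-bound f g {ps} {x} {n} ps-prime x≥rhs = subst (ℚ._≤ ι x) (sym rhs≡ι⟨rhs⟩) (ι-mono-≤ x≥rhs)
  where
  open ≡-Reasoning
  open ℚSolver.+-*-Solver
  A = sumℤ (map f ps)
  B = sumℤ (map g ps)
  K = + (2 ℕ.* length ps)
  T = sumℚ (map (λ p → (+ 2 ℚ./ 1) ℚ.* inv p) ps)
  rhs≡ι⟨rhs⟩ : sumℚ (map (λ p → (ι (f p) ℚ.- θ p ℚ.* ι n) ℚ.+ (ι (g p) ℚ.- θ p ℚ.* ι n)) ps) ℚ.+ (1ℚ ℚ.- T) ℚ.* ι n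
              ≡ ι ((A ℤ.+ B) ℤ.- ((K ℤ.- + 1) ℤ.* n))
  rhs≡ι⟨rhs⟩ = begin
    sumℚ (map (λ p → (ι (f p) ℚ.- θ p ℚ.* ι n) ℚ.+ (ι (g p) ℚ.- θ p ℚ.* ι n)) ps) ℚ.+ (1ℚ ℚ.- T) ℚ.* ι n
      ≡⟨ cong (ℚ._+ (1ℚ ℚ.- T) ℚ.* ι n) (sumℚ-θ-terms (λ p → ι (f p)) (λ p → ι (g p)) (ι n) ps-prime) ⟩
    ((sumℚ (map (λ p → ι (f p)) ps) ℚ.+ sumℚ (map (λ p → ι (g p)) ps)) ℚ.- (ι K ℚ.- T) ℚ.* ι n) ℚ.+ (1ℚ ℚ.- T) ℚ.* ι n
      ≡⟨ cong₂ (λ a b → ((a ℚ.+ b) ℚ.- (ι K ℚ.- T) ℚ.* ι n) ℚ.+ (1ℚ ℚ.- T) ℚ.* ι n) (ι-sumℤ-map f ps) (ι-sumℤ-map g ps) ⟨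
    ((ι A ℚ.+ ι B) ℚ.- (ι K ℚ.- T) ℚ.* ι n) ℚ.+ (1ℚ ℚ.- T) ℚ.* ι n
      ≡⟨ solve 5 (λ a b k t y → ((a :+ b) :- (k :- t) :* y) :+ (con 1ℚ :- t) :* y := (a :+ b) :- (k :- con 1ℚ) :* y)
           refl (ι A) (ι B) (ι K) T (ι n) ⟩
    (ι A ℚ.+ ι B) ℚ.- (ι K ℚ.- 1ℚ) ℚ.* ι n
      ≡⟨ cong₂ (λ s t → s ℚ.- t ℚ.* ι n) (ι-+ A B) (ι-‐ K (+ 1)) ⟨
    ι (A ℤ.+ B) ℚ.- ι (K ℤ.- + 1) ℚ.* ι n
      ≡⟨ trans (ι-‐ (A ℤ.+ B) _) (cong (ℚ._-_ (ι (A ℤ.+ B))) (ι-* (K ℤ.- + 1) n)) ⟨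
    ι ((A ℤ.+ B) ℤ.- ((K ℤ.- + 1) ℤ.* n)) ∎

-- Free elements

module _ (F : FiniteField) where

  open FiniteField F
  open IsCommutativeRing isCommutativeRing using (*-assoc; *-identityˡ)

  pow-+ : ∀ h m n → pow h (m ℕ.+ n) ≡ pow h m * pow h n
  pow-+ h zero    n = sym (*-identityˡ _)
  pow-+ h (suc m) n = trans (cong (h *_) (pow-+ h m n)) (sym (*-assoc h _ _))

  pow-* : ∀ h r m → pow h (r ℕ.* m) ≡ pow (pow h m) r
  pow-* h zero    m = refl
  pow-* h (suc r) m = trans (pow-+ h m (r ℕ.* m)) (cong (pow h m *_) (pow-* h r m))

  IsFree-anti-∣ : ∀ {f f′ g} → f′ ∣ f → IsFree f g → IsFree f′ g
  IsFree-anti-∣ f′∣f (g≢0 , f-free) = g≢0 , λ h d d∣f′ → f-free h d (∣-trans d∣f′ f′∣f)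

  IsFree-of-prime-divisors : ∀ {m g} .{{_ : NonZero m}} → g ≢ 0# →
                             (∀ {r} → Prime r → r ∣ m → IsFree r g) → IsFree m g
  IsFree-of-prime-divisors {m} {g} g≢0 prime-free = g≢0 , m-free
    where
    m-free : ∀ h d → d ∣ m → g ≡ pow h d → d ≡ 1
    m-free h zero            0∣m _ = contradiction (0∣⇒≡0 0∣m) (ℕ.≢-nonZero⁻¹ m)
    m-free h (suc zero)      _   _ = refl
    m-free h d@(suc (suc _)) d∣m g≡hᵈ with prime-divisor d
    ... | r , r-prime , r∣d@(divides j d≡j*r) =
      contradiction (proj₂ (prime-free r-prime (∣-trans r∣d d∣m)) (pow h j) r ∣-refl g≡⟨hʲ⟩ʳ)
                    (ℕ.nonTrivial⇒≢1 {{prime⇒nonTrivial r-prime}})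
      where
      g≡⟨hʲ⟩ʳ : g ≡ pow (pow h j) r
      g≡⟨hʲ⟩ʳ = trans g≡hᵈ (trans (cong (pow h) (trans d≡j*r (ℕP.*-comm j r))) (pow-* h r j))

  IsFree-of-primesDividingNotDividing : ∀ {m e g} .{{_ : NonZero m}} → IsFree e g →
    (∀ {p} → p ∈ primesDividingNotDividing m e → IsFree (p ℕ.* e) g) → IsFree m g
  IsFree-of-primesDividingNotDividing {m} {e} {g} e-free pe-free = IsFree-of-prime-divisors (proj₁ e-free) r-free
    where
    r-free : ∀ {r} → Prime r → r ∣ m → IsFree r g
    r-free {r} r-prime r∣m with r ∣? e
    ... | yes r∣e = IsFree-anti-∣ r∣e e-free
    ... | no  r∤e = IsFree-anti-∣ (m∣m*n e) (pe-free (∈-primesDividingNotDividing⁺ r-prime r∣m r∤e))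

  module _ {a c : Carrier} {e : ℕ} .{{_ : NonZero (order ∸ 1)}} (e∣m : e ∣ order ∸ 1) (N : ℕ → ℕ → ℕ)
           (N-counts : ∀ e₁ e₂ → e₁ ∣ order ∸ 1 → e₂ ∣ order ∸ 1 → IsN a c e₁ e₂ (N e₁ e₂)) where

    private
      m : ℕ
      m = order ∸ 1

      ps : List ℕ
      ps = primesDividingNotDividing m e

      Good : ℕ → ℕ → Carrier → Set
      Good e₁ e₂ g = IsFree e₁ g × IsFree e₂ (a - (c * g))

      -- The list witnessing N e₁ e₂; it is junk ([]) unless both e₁ and e₂ divide m.
      counted : ℕ → ℕ → List Carrier
      counted e₁ e₂ with e₁ ∣? m | e₂ ∣? m
      ... | yes e₁∣m | yes e₂∣m = proj₁ (N-counts e₁ e₂ e₁∣m e₂∣m)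
      ... | _        | _        = []

      counted-spec : ∀ {e₁ e₂} → e₁ ∣ m → e₂ ∣ m →
        Unique (counted e₁ e₂) × (∀ g → (g ∈ counted e₁ e₂) ⇔ Good e₁ e₂ g) × length (counted e₁ e₂) ≡ N e₁ e₂
      counted-spec {e₁} {e₂} e₁∣m e₂∣m with e₁ ∣? m | e₂ ∣? m
      ... | yes e₁∣m′ | yes e₂∣m′ = proj₂ (N-counts e₁ e₂ e₁∣m′ e₂∣m′)
      ... | no  e₁∤m  | _         = contradiction e₁∣m e₁∤m
      ... | yes _     | no  e₂∤m  = contradiction e₂∣m e₂∤m

      counted-unique : ∀ {e₁ e₂} → e₁ ∣ m → e₂ ∣ m → Unique (counted e₁ e₂)
      counted-unique e₁∣m e₂∣m = proj₁ (counted-spec e₁∣m e₂∣m)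

      counted⁻ : ∀ {e₁ e₂ g} → e₁ ∣ m → e₂ ∣ m → g ∈ counted e₁ e₂ → Good e₁ e₂ g
      counted⁻ {g = g} e₁∣m e₂∣m = Equivalence.to (proj₁ (proj₂ (counted-spec e₁∣m e₂∣m)) g)

      counted⁺ : ∀ {e₁ e₂ g} → e₁ ∣ m → e₂ ∣ m → Good e₁ e₂ g → g ∈ counted e₁ e₂
      counted⁺ {g = g} e₁∣m e₂∣m = Equivalence.from (proj₁ (proj₂ (counted-spec e₁∣m e₂∣m)) g)

      length-counted : ∀ {e₁ e₂} → e₁ ∣ m → e₂ ∣ m → length (counted e₁ e₂) ≡ N e₁ e₂
      length-counted e₁∣m e₂∣m = proj₂ (proj₂ (counted-spec e₁∣m e₂∣m))

      pe∣m : ∀ {p} → p ∈ ps → p ℕ.* e ∣ m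
      pe∣m p∈ps with ∈-primesDividingNotDividing⁻ p∈ps
      ... | p-prime , p∣m , p∤e = prime∤⇒*∣ p-prime p∤e p∣m e∣m

      E X : List Carrier
      E = counted e e
      X = counted m m

      Ls : List (List Carrier)
      Ls = map (λ p → counted (p ℕ.* e) e) ps ++ map (λ p → counted e (p ℕ.* e)) ps

      Ls-unique : All Unique Ls
      Ls-unique = All-++⁺ (All-map⁺ (All.tabulate λ p∈ps → counted-unique (pe∣m p∈ps) e∣m))
                          (All-map⁺ (All.tabulate λ p∈ps → counted-unique e∣m (pe∣m p∈ps)))

      Ls⊆E : All (_⊆ E) Ls
      Ls⊆E = All-++⁺ (All-map⁺ (All.tabulate λ {p} p∈ps g∈ → left p (counted⁻ (pe∣m p∈ps) e∣m g∈)))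
                     (All-map⁺ (All.tabulate λ {p} p∈ps g∈ → right p (counted⁻ e∣m (pe∣m p∈ps) g∈)))
        where
        left : ∀ p {g} → Good (p ℕ.* e) e g → g ∈ E
        left p (pe-free , e-free) = counted⁺ e∣m e∣m (IsFree-anti-∣ (n∣m*n p) pe-free , e-free)
        right : ∀ p {g} → Good e (p ℕ.* e) g → g ∈ E
        right p (e-free , pe-free) = counted⁺ e∣m e∣m (e-free , IsFree-anti-∣ (n∣m*n p) pe-free)

      E∩Ls⊆X : ∀ {g} → g ∈ E → All (g ∈_) Ls → g ∈ X
      E∩Ls⊆X g∈E g∈Ls with ++⁻ (map (λ p → counted (p ℕ.* e) e) ps) g∈Ls | counted⁻ e∣m e∣m g∈E
      ... | g∈Bs , g∈Cs | g-free , g*-free = counted⁺ ∣-refl ∣-refl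
        ( IsFree-of-primesDividingNotDividing g-free  (λ p∈ps → proj₁ (counted⁻ (pe∣m p∈ps) e∣m (All.lookup (map⁻ g∈Bs) p∈ps)))
        , IsFree-of-primesDividingNotDividing g*-free (λ p∈ps → proj₂ (counted⁻ e∣m (pe∣m p∈ps) (All.lookup (map⁻ g∈Cs) p∈ps))))

      sum-length-Ls : sum (map length Ls) ≡ sum (map (λ p → N (p ℕ.* e) e) ps) ℕ.+ sum (map (λ p → N e (p ℕ.* e)) ps)
      sum-length-Ls = begin
        sum (map length Ls)
          ≡⟨ cong sum (map-++ length (map (λ p → counted (p ℕ.* e) e) ps) _) ⟩
        sum (map length (map (λ p → counted (p ℕ.* e) e) ps) ++ map length (map (λ p → counted e (p ℕ.* e)) ps))
          ≡⟨ sum-++ (map length (map (λ p → counted (p ℕ.* e) e) ps)) _ ⟩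
        sum (map length (map (λ p → counted (p ℕ.* e) e) ps)) ℕ.+ sum (map length (map (λ p → counted e (p ℕ.* e)) ps))
          ≡⟨ cong₂ (λ s t → sum s ℕ.+ sum t) (map-∘ ps) (map-∘ ps) ⟨
        sum (map (λ p → length (counted (p ℕ.* e) e)) ps) ℕ.+ sum (map (λ p → length (counted e (p ℕ.* e))) ps)
          ≡⟨ cong₂ (λ s t → sum s ℕ.+ sum t)
               (map-cong-local (All.tabulate λ p∈ps → length-counted (pe∣m p∈ps) e∣m))
               (map-cong-local (All.tabulate λ p∈ps → length-counted e∣m (pe∣m p∈ps))) ⟩
        sum (map (λ p → N (p ℕ.* e) e) ps) ℕ.+ sum (map (λ p → N e (p ℕ.* e)) ps) ∎
        where open ≡-Reasoning

      length-Ls : length Ls ≡ 2 ℕ.* length ps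
      length-Ls = trans (length-++ (map (λ p → counted (p ℕ.* e) e) ps))
                        (cong₂ ℕ._+_ (length-map _ ps) (trans (length-map _ ps) (sym (ℕP.+-identityʳ (length ps)))))

    counting-bound : N e e ℕ.+ (sum (map (λ p → N (p ℕ.* e) e) ps) ℕ.+ sum (map (λ p → N e (p ℕ.* e)) ps))
                     ≤ N m m ℕ.+ 2 ℕ.* length ps ℕ.* N e e
    counting-bound = decidable-stable (_ ℕ.≤? _) (¬¬-map bound (¬¬-decEq-of-enumeration elements complete))
      where
      bound : DecidableEquality Carrier →
              N e e ℕ.+ (sum (map (λ p → N (p ℕ.* e) e) ps) ℕ.+ sum (map (λ p → N e (p ℕ.* e)) ps))
                ≤ N m m ℕ.+ 2 ℕ.* length ps ℕ.* N e e
      bound _≟_ = subst₂ _≤_ (cong₂ ℕ._+_ (length-counted e∣m e∣m) sum-length-Ls)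
                             (cong₂ ℕ._+_ (length-counted ∣-refl ∣-refl) (cong₂ ℕ._*_ length-Ls (length-counted e∣m e∣m)))
                             (counting _≟_ Ls (counted-unique e∣m e∣m) Ls-unique Ls⊆E E∩Ls⊆X)

lemma1 : (F : FiniteField) → let open FiniteField F in
    (∃ λ p → Σ ℕ λ k → Prime p × k ≥ 1 × order ≡ p ^ k) →
    (a c : Carrier) → a ≢ 0# → c ≢ 0# →
    (e : ℕ) → e ≥ 1 → e ∣ order ∸ 1 →
    (N : ℕ → ℕ → ℕ) →
    (∀ e₁ e₂ → e₁ ∣ order ∸ 1 → e₂ ∣ order ∸ 1 → IsN a c e₁ e₂ (N e₁ e₂)) →
    let ps = primesDividingNotDividing (order ∸ 1) e
        s  = length ps
        δ  = 1ℚ ℚ.- sumℚ (map (λ p → (+ 2 ℚ./ 1) ℚ.* inv p) ps)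
        Nee = N e e
    in (+ N (order ∸ 1) (order ∸ 1) ℤ.≥
          (sumℤ (map (λ p → + N (p ℕ.* e) e) ps) ℤ.+ sumℤ (map (λ p → + N e (p ℕ.* e)) ps))
          ℤ.- ((+ (2 ℕ.* s) ℤ.- + 1) ℤ.* + Nee))
     × ((+ N (order ∸ 1) (order ∸ 1) ℚ./ 1) ℚ.≥
          sumℚ (map (λ p → ((+ N (p ℕ.* e) e ℚ./ 1) ℚ.- θ p ℚ.* (+ Nee ℚ./ 1))
                       ℚ.+ ((+ N e (p ℕ.* e) ℚ./ 1) ℚ.- θ p ℚ.* (+ Nee ℚ./ 1))) ps)
          ℚ.+ δ ℚ.* (+ Nee ℚ./ 1))
lemma1 F (p , k , p-prime , k≥1 , q≡pᵏ) a c _ _ e _ e∣m N N-counts =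
  < id , ℤ-bound⇒ℚ-bound (λ p → + N (p ℕ.* e) e) (λ p → + N e (p ℕ.* e)) ps-prime >
    (ℕ≤⇒ℤ-bound (λ p → N (p ℕ.* e) e) (λ p → N e (p ℕ.* e)) ps {k = 2 ℕ.* length ps}
      (counting-bound F e∣m N N-counts))
  where
  open FiniteField F using (order)
  instance
    m≢0 : NonZero (order ∸ 1)
    m≢0 = ℕ.>-nonZero (ℕP.m<n⇒0<n∸m (subst (1 <_) (sym q≡pᵏ) (prime^suc>1 p-prime k≥1)))
  ps : List ℕ
  ps = primesDividingNotDividing (order ∸ 1) e
  ps-prime : All Prime ps
  ps-prime = All.tabulate (λ p∈ps → proj₁ (∈-primesDividingNotDividing⁻ {order ∸ 1} {e} p∈ps))
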